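{- For any positive integers $r\le d$, $$N_{d,r}(s)=\begin{cases}1, & s=1,\\ N_{d,r}(s-1)+N_{d,r}(s-d-1), & s\ge 2,\end{cases}$$ where $s$ ranges over positive integers and $N_{d,r}$ at nonpositive arguments is given by the extension described in the context.
   Context: A partition $\lambda=(\lambda_1,\dots,\lambda_k)$ is a finite nonincreasing sequence of positive integers (the empty partition is allowed). In its Young diagram (row $i$ has $\lambda_i$ left-justified cells), the hook length $h(i,j)$ of cell $(i,j)$ is $1$ plus the number of cells to its right in its row plus the number of cells below it in its column. For a positive integer $t$, $\lambda$ is $t$-core if no cell has hook length $t$; it is $(s,s+r)$-core if it is both $s$-core and $(s+r)$-core. $\lambda$ has $d$-distinct parts if $\lambda_i-\lambda_{i+1}\ge d$ for all $1\le i\le k-1$. For positive integers $d,r,s$, $N_{d,r}(s)$ is the number of $(s,s+r)$-core partitions with $d$-distinct parts. A set $S\subseteq\mathbb{Z}$ is $d$-th order twin-free if $|x-y|>d$ for all distinct $x,y\in S$. Extension: for positive integers $r\le d$ and integers $s\le 0$, $N_{d,r}(s)$ is defined as the number of subsets $\beta\subseteq\{1,2,\dots,s+r-1\}$ (empty if $s+r-1\le0$) such that (1) $x-s\in\beta$ for all $x\in\beta$ with $x\ge s$; (2) $x-(s+r)\in\beta$ for all $x\in\beta$ with $x\ge s+r$; (3) $\beta$ is $d$-th order twin-free. -}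

module Defs where

open import Data.Nat as ℕ using (ℕ; zero; suc; _+_; _∸_; _≤_; _<_; _<ᵇ_)
open import Data.Integer as ℤ using (ℤ; +_; -[1+_]; ∣_∣)
open import Data.List using (List; []; _∷_; length; filter)
open import Data.List.Membership.Propositional using (_∈_)
open import Data.List.Relation.Unary.All using (All)
open import Data.List.Relation.Unary.Linked using (Linked)
open import Data.List.Relation.Unary.Unique.Propositional using (Unique)
open import Data.Product using (Σ; _×_)
open import Data.Bool using (T)
open import Function.Bundles using (_⇔_)
open import Relation.Binary.PropositionalEquality using (_≡_; _≢_)
open import Relation.Nullary.Decidable using ()
import Data.Nat.Properties as ℕP

HasCard : {A : Set} → (A → Set) → ℕ → Set
HasCard {A} P n =
  Σ (List A) λ xs → Unique xs × (∀ x → P x ⇔ x ∈ xs) × length xs ≡ n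

-- Partitions as lists of parts (λ₁, λ₂, …, λ_k).  Rows/columns are
-- 0-indexed here: cell (i , j) means row i+1, column j+1.

part : List ℕ → ℕ → ℕ
part []       _       = 0
part (x ∷ _)  zero    = x
part (_ ∷ xs) (suc i) = part xs i

IsPartition : List ℕ → Set
IsPartition la = All (λ x → 0 < x) la × (∀ i → part la (suc i) ≤ part la i)

colLen : List ℕ → ℕ → ℕ
colLen la j = length (filter (λ x → j ℕ.<? x) la)

-- hook length of the cell (i , j):
--   1 + (cells to the right) + (cells below)
--   = 1 + (λ_i - j - 1) + (λ'_j - i - 1)
hook : List ℕ → ℕ → ℕ → ℕ
hook la i j = suc ((part la i ∸ suc j) + (colLen la j ∸ suc i))

IsCell : List ℕ → ℕ → ℕ → Set
IsCell la i j = i < length la × j < part la i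

IsCore : ℕ → List ℕ → Set
IsCore t la = ∀ i j → IsCell la i j → hook la i j ≢ t

DDistinct : ℕ → List ℕ → Set
DDistinct d la = ∀ i → suc i < length la → part la (suc i) + d ≤ part la i

CoreDD : ℕ → ℕ → ℕ → List ℕ → Set
CoreDD d r s la =
  IsPartition la × IsCore s la × IsCore (s + r) la × DDistinct d la

-- Extension to s ≤ 0: subsets β ⊆ {1,…,s+r-1}, represented canonically
-- as strictly increasing lists of integers.

ExtSet : ℕ → ℕ → ℤ → List ℤ → Set
ExtSet d r s β =
  Linked ℤ._<_ β ×
  All (λ x → (+ 1 ℤ.≤ x) × (x ℤ.≤ (s ℤ.+ + r) ℤ.- + 1)) β ×
  (∀ x → x ∈ β → s ℤ.≤ x → x ℤ.- s ∈ β) ×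
  (∀ x → x ∈ β → s ℤ.+ + r ℤ.≤ x → x ℤ.- (s ℤ.+ + r) ∈ β) ×
  (∀ x y → x ∈ β → y ∈ β → x ≢ y → d < ∣ x ℤ.- y ∣)

NCount : ℕ → ℕ → ℤ → ℕ → Set
NCount d r (+ zero)    n = HasCard (ExtSet d r (+ zero)) n
NCount d r (+ (suc m)) n = HasCard (CoreDD d r (suc m)) n
NCount d r -[1+ m ]    n = HasCard (ExtSet d r -[1+ m ]) n

-- Via β-sets (first-column hook lengths), partitions with d-distinct parts correspond to
-- decreasing lists of positive integers with consecutive gaps greater than d, and t-cores to
-- sets closed under subtracting t. If such a set is closed under subtracting s and s + r with
-- r ≤ d, then all its elements are below s except possibly the largest one B, and in that case
-- B - s lies in the set and is below r. So N(s) = T(s - 1) + O(s), where T(n) counts the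
-- twin-free subsets of {1, …, n} and satisfies T(n) = T(n - 1) + T(n - d - 1) (split on whether
-- n is used), and O(s) counts the sets with a largest element above s. O vanishes for s ≤ d, is
-- r - 1 at s = d + 1 and beyond satisfies the same recurrence (split on whether the two largest
-- elements are exactly d + 1 apart). For s ≤ 0 the extended sets are only ∅ (s < 0), or ∅ and
-- the singletons {a} with 1 ≤ a < r (s = 0), which gives the boundary values.

module Submission where

open import Defs
open import Data.Nat using (ℕ; zero; suc; pred; _+_; _∸_; _⊔_; _≤_; _<_; z≤n; s≤s; s≤s⁻¹)
open import Data.Nat.Properties
open import Data.Nat.Induction using (<-rec)
open import Data.Nat.Tactic.RingSolver using (solve-∀)
open import Algebra.Properties.CommutativeSemigroup +-commutativeSemigroup using (xy∙z≈xz∙y; interchange)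
open import Data.Integer using (ℤ; +_; -[1+_]; _-_; ∣_∣)
import Data.Integer as ℤ
import Data.Integer.Properties as ℤP
open import Data.List using (List; []; _∷_; length; map; _++_; drop)
open import Data.List.Properties using (length-map; length-++; filter-accept; filter-reject)
open import Data.List.Membership.Propositional using (_∈_; _∉_)
open import Data.List.Membership.Propositional.Properties using (∈-map⁺; ∈-map⁻; ∈-++⁺ˡ; ∈-++⁺ʳ; ∈-++⁻)
open import Data.List.Membership.DecPropositional _≟_ using (_∈?_)
open import Data.List.Relation.Unary.Any using (here; there)
open import Data.List.Relation.Unary.All as All using (All; []; _∷_)
open import Data.List.Relation.Unary.All.Properties using (map⁺)
open import Data.List.Relation.Unary.AllPairs using ([]; _∷_)
import Data.List.Relation.Unary.Linked as Linked
open import Data.List.Relation.Unary.Unique.Propositional using (Unique)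
open import Data.List.Relation.Unary.Unique.Propositional.Properties using (++⁺)
open import Data.Product using (Σ; _×_; _,_; ∃; proj₁; proj₂)
open import Data.Product.Function.NonDependent.Propositional using (_×-⇔_)
open import Data.Sum using (_⊎_; inj₁; inj₂)
open import Data.Empty using (⊥; ⊥-elim)
open import Data.Unit using (⊤; tt)
open import Function using (_∘_; id)
open import Function.Bundles using (_⇔_; mk⇔; Equivalence)
open import Function.Construct.Composition using (_⇔-∘_)
open import Relation.Nullary using (¬_; yes; no)
open import Relation.Binary.Definitions using (tri<; tri≈; tri>)
open import Relation.Binary.PropositionalEquality using (_≡_; _≢_; refl; sym; trans; cong; cong₂; subst; module ≡-Reasoning)

open Equivalence

private
  variable
    A B : Set
    m n : ℕ

-- Cardinalities

map-Unique : (f : A → B) {xs : List A} →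
  (∀ {x y} → x ∈ xs → y ∈ xs → f x ≡ f y → x ≡ y) → Unique xs → Unique (map f xs)
map-Unique f inj [] = []
map-Unique f inj (x∉xs ∷ u) =
  map⁺ (All.tabulate (λ y∈xs fx≡fy → All.lookup x∉xs y∈xs (inj (here refl) (there y∈xs) fx≡fy)))
  ∷ map-Unique f (λ x∈ y∈ → inj (there x∈) (there y∈)) u

HasCard-bijection : {P : A → Set} {Q : B → Set} (f : B → A) (g : A → B) →
  (∀ b → Q b → P (f b)) → (∀ a → P a → Q (g a)) →
  (∀ b → Q b → g (f b) ≡ b) → (∀ a → P a → f (g a) ≡ a) →
  HasCard Q n → HasCard P n
HasCard-bijection {P = P} f g f-maps g-maps g∘f f∘g (ys , u , mem , len) =
  map f ys , map-Unique f inj u , (λ a → mk⇔ (into a) (outof a)) , trans (length-map f ys) len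
  where
  inj : ∀ {x y} → x ∈ ys → y ∈ ys → f x ≡ f y → x ≡ y
  inj {x} {y} x∈ y∈ fx≡fy =
    trans (sym (g∘f x (from (mem x) x∈))) (trans (cong g fx≡fy) (g∘f y (from (mem y) y∈)))
  into : ∀ a → P a → a ∈ map f ys
  into a pa = subst (_∈ map f ys) (f∘g a pa) (∈-map⁺ f (to (mem (g a)) (g-maps a pa)))
  outof : ∀ a → a ∈ map f ys → P a
  outof a a∈ with ∈-map⁻ f a∈
  ... | b , b∈ , refl = f-maps b (from (mem b) b∈)

HasCard-⊎ : {P Q R : A → Set} → (∀ x → P x ⇔ (Q x ⊎ R x)) → (∀ x → Q x → R x → ⊥) →
  HasCard Q m → HasCard R n → HasCard P (m + n)
HasCard-⊎ {P = P} split disjoint (xs , u , mx , lx) (ys , v , my , ly) =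
  xs ++ ys , ++⁺ u v (λ {z} (z∈xs , z∈ys) → disjoint z (from (mx z) z∈xs) (from (my z) z∈ys)) ,
  (λ z → mk⇔ (into z) (outof z)) , trans (length-++ xs) (cong₂ _+_ lx ly)
  where
  into : ∀ z → P z → z ∈ xs ++ ys
  into z pz with to (split z) pz
  ... | inj₁ qz = ∈-++⁺ˡ (to (mx z) qz)
  ... | inj₂ rz = ∈-++⁺ʳ xs (to (my z) rz)
  outof : ∀ z → z ∈ xs ++ ys → P z
  outof z z∈ with ∈-++⁻ xs z∈
  ... | inj₁ z∈xs = from (split z) (inj₁ (from (mx z) z∈xs))
  ... | inj₂ z∈ys = from (split z) (inj₂ (from (my z) z∈ys))

HasCard-empty : {P : A → Set} → (∀ x → ¬ P x) → HasCard P 0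
HasCard-empty ¬p = [] , [] , (λ x → mk⇔ (λ px → ⊥-elim (¬p x px)) (λ ())) , refl

HasCard-singleton : {P : A → Set} (c : A) → (∀ x → P x → x ≡ c) → P c → HasCard P 1
HasCard-singleton {P = P} c unique pc =
  c ∷ [] , [] ∷ [] , (λ x → mk⇔ (λ px → here (unique x px)) (outof x)) , refl
  where
  outof : ∀ x → x ∈ c ∷ [] → P x
  outof x (here refl) = pc

Between : ℕ → ℕ → Set
Between r a = 1 ≤ a × a < r

Between-card : ∀ r → HasCard (Between r) (r ∸ 1)
Between-card zero = HasCard-empty (λ { a (_ , ()) })
Between-card (suc zero) = HasCard-empty (λ { a (1≤a , a<1) → 1+n≰n (≤-trans (s≤s 1≤a) a<1) })
Between-card (suc (suc r)) = subst (HasCard (Between (2 + r))) (+-comm r 1)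
  (HasCard-⊎ (λ a → mk⇔ (split a) (join a)) disjoint (Between-card (suc r))
             (HasCard-singleton (suc r) (λ _ eq → eq) refl))
  where
  split : ∀ a → Between (2 + r) a → Between (suc r) a ⊎ a ≡ suc r
  split a (1≤a , a<2+r) with m≤n⇒m<n∨m≡n (s≤s⁻¹ a<2+r)
  ... | inj₁ a<1+r = inj₁ (1≤a , a<1+r)
  ... | inj₂ a≡1+r = inj₂ a≡1+r
  join : ∀ a → Between (suc r) a ⊎ a ≡ suc r → Between (2 + r) a
  join a (inj₁ (1≤a , a<1+r)) = 1≤a , m<n⇒m<1+n a<1+r
  join a (inj₂ refl) = s≤s z≤n , ≤-refl
  disjoint : ∀ a → Between (suc r) a → a ≡ suc r → ⊥
  disjoint a (_ , a<1+r) refl = 1+n≰n a<1+r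

-- Twin-free sets

Headed : ℕ → (List ℕ → Set) → List ℕ → Set
Headed c Q [] = ⊥
Headed c Q (x ∷ l) = x ≡ c × Q l

HasCard-Headed : (c : ℕ) {Q : List ℕ → Set} → HasCard Q n → HasCard (Headed c Q) n
HasCard-Headed c {Q} = HasCard-bijection (c ∷_) (drop 1) (λ _ q → refl , q) unheaded (λ _ _ → refl) reheaded
  where
  unheaded : ∀ l → Headed c Q l → Q (drop 1 l)
  unheaded (_ ∷ l) (_ , q) = q
  reheaded : ∀ l → Headed c Q l → c ∷ drop 1 l ≡ l
  reheaded (_ ∷ l) (refl , _) = refl

TwinFree : ℕ → List ℕ → Set
TwinFree d [] = ⊤
TwinFree d (x ∷ []) = 1 ≤ x
TwinFree d (x ∷ y ∷ l) = y + d < x × TwinFree d (y ∷ l)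

HeadAtMost : ℕ → List ℕ → Set
HeadAtMost n [] = ⊤
HeadAtMost n (x ∷ _) = x ≤ n

TwinFreeUpTo : ℕ → ℕ → List ℕ → Set
TwinFreeUpTo d n l = TwinFree d l × HeadAtMost n l

module _ {d : ℕ} where

  TwinFree-head : ∀ {x} l → TwinFree d (x ∷ l) → 1 ≤ x
  TwinFree-head [] 1≤x = 1≤x
  TwinFree-head (y ∷ l) (y+d<x , tf) =
    ≤-trans (TwinFree-head l tf) (≤-trans (m≤m+n y d) (<⇒≤ y+d<x))

  TwinFree-tail : ∀ {x} l → TwinFree d (x ∷ l) → TwinFree d l
  TwinFree-tail [] _ = tt
  TwinFree-tail (y ∷ l) (_ , tf) = tf

  TwinFree-tail-head : ∀ {x} l → TwinFree d (x ∷ l) → HeadAtMost (x ∸ suc d) l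
  TwinFree-tail-head [] _ = tt
  TwinFree-tail-head {x} (y ∷ l) (y+d<x , _) =
    m+n≤o⇒m≤o∸n y (subst (_≤ x) (sym (+-suc y d)) y+d<x)

  TwinFree-∷ : ∀ {x} l → 1 ≤ x → TwinFree d l → HeadAtMost (x ∸ suc d) l → TwinFree d (x ∷ l)
  TwinFree-∷ [] 1≤x _ _ = 1≤x
  TwinFree-∷ {x} (y ∷ l) 1≤x tf y≤x∸1+d =
    subst (_≤ x) (+-suc y d) (m≤o∸n⇒m+n≤o y 1+d≤x y≤x∸1+d) , tf
    where
    1+d≤x : suc d ≤ x
    1+d≤x = <⇒≤ (m∸n≢0⇒n<m λ x∸1+d≡0 →
      1+n≰n (subst (1 ≤_) x∸1+d≡0 (≤-trans (TwinFree-head l tf) y≤x∸1+d)))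

  TwinFree-below : ∀ {x y} l → TwinFree d (x ∷ l) → y ∈ l → y + suc d ≤ x
  TwinFree-below {x} {y} (_ ∷ l) (y+d<x , _) (here refl) = subst (_≤ x) (sym (+-suc y d)) y+d<x
  TwinFree-below {x} (z ∷ l) (z+d<x , tf) (there y∈l) =
    ≤-trans (TwinFree-below l tf y∈l) (≤-trans (m≤m+n z d) (<⇒≤ z+d<x))

  TwinFree-below-head : ∀ {B} l → TwinFree d (B ∷ l) → All (_< B) l
  TwinFree-below-head l tf = All.tabulate λ y∈l → ≤-trans (m<m+n _ (s≤s z≤n)) (TwinFree-below l tf y∈l)

  TwinFree-pos : ∀ {y} l → TwinFree d l → y ∈ l → 1 ≤ y
  TwinFree-pos (x ∷ l) tf (here refl) = TwinFree-head l tf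
  TwinFree-pos (x ∷ l) tf (there y∈l) = TwinFree-pos l (TwinFree-tail l tf) y∈l

  TwinFree-apart : ∀ {x y} l → TwinFree d l → x ∈ l → y ∈ l → x < y → x + suc d ≤ y
  TwinFree-apart (z ∷ l) tf (here refl) (here refl) x<y = ⊥-elim (1+n≰n x<y)
  TwinFree-apart (z ∷ l) tf (here refl) (there y∈l) x<y =
    ⊥-elim (<-asym x<y (≤-trans (m<m+n _ (s≤s z≤n)) (TwinFree-below l tf y∈l)))
  TwinFree-apart (z ∷ l) tf (there x∈l) (here refl) _ = TwinFree-below l tf x∈l
  TwinFree-apart (z ∷ l) tf (there x∈l) (there y∈l) x<y =
    TwinFree-apart l (TwinFree-tail l tf) x∈l y∈l x<y

  twinFreeUpTo-zero : HasCard (TwinFreeUpTo d 0) 1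
  twinFreeUpTo-zero = HasCard-singleton [] only-[] (tt , tt)
    where
    only-[] : ∀ l → TwinFreeUpTo d 0 l → l ≡ []
    only-[] [] _ = refl
    only-[] (x ∷ l) (tf , x≤0) = ⊥-elim (1+n≰n (≤-trans (TwinFree-head l tf) x≤0))

  twinFreeUpTo-suc : ∀ {n x y} → HasCard (TwinFreeUpTo d n) x → HasCard (TwinFreeUpTo d (n ∸ d)) y →
    HasCard (TwinFreeUpTo d (suc n)) (x + y)
  twinFreeUpTo-suc {n} hx hy =
    HasCard-⊎ (λ l → mk⇔ (split l) (join l)) disjoint hx (HasCard-Headed (suc n) hy)
    where
    split : ∀ l → TwinFreeUpTo d (suc n) l → TwinFreeUpTo d n l ⊎ Headed (suc n) (TwinFreeUpTo d (n ∸ d)) l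
    split [] _ = inj₁ (tt , tt)
    split (x ∷ l) (tf , x≤1+n) with x ≤? n
    ... | yes x≤n = inj₁ (tf , x≤n)
    ... | no x≰n with ≤-antisym x≤1+n (≰⇒> x≰n)
    ...   | refl = inj₂ (refl , TwinFree-tail l tf , TwinFree-tail-head l tf)
    join : ∀ l → TwinFreeUpTo d n l ⊎ Headed (suc n) (TwinFreeUpTo d (n ∸ d)) l → TwinFreeUpTo d (suc n) l
    join [] _ = tt , tt
    join (x ∷ l) (inj₁ (tf , x≤n)) = tf , m≤n⇒m≤1+n x≤n
    join (x ∷ l) (inj₂ (refl , tf , hd)) = TwinFree-∷ l (s≤s z≤n) tf hd , ≤-refl
    disjoint : ∀ l → TwinFreeUpTo d n l → Headed (suc n) (TwinFreeUpTo d (n ∸ d)) l → ⊥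
    disjoint (x ∷ l) (_ , x≤n) (refl , _) = 1+n≰n x≤n

  twinFreeUpTo-finite : ∀ n → ∃ (HasCard (TwinFreeUpTo d n))
  twinFreeUpTo-finite = <-rec _ λ where
    zero _ → 1 , twinFreeUpTo-zero
    (suc n) rec →
      let x , hx = rec (n<1+n n)
          y , hy = rec (s≤s (m∸n≤m n d))
      in x + y , twinFreeUpTo-suc hx hy

-- Sets whose largest element overhangs s

≤-or-above : ∀ d s → s ≤ d ⊎ ∃ λ m → s ≡ suc (m + d)
≤-or-above d zero = inj₁ z≤n
≤-or-above d (suc s) with s <? d
... | yes s<d = inj₁ s<d
... | no s≮d = inj₂ (s ∸ d , cong suc (sym (m∸n+n≡m (≮⇒≥ s≮d))))

Overhang : ℕ → ℕ → ℕ → List ℕ → Set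
Overhang d r s [] = ⊥
Overhang d r s (B ∷ l) = Σ ℕ λ a → B ≡ s + a × Between r a × TwinFree d (B ∷ l) × a ∈ l

module _ {d r : ℕ} where

  overhang-empty : ∀ {s} → s ≤ d → ∀ l → ¬ Overhang d r s l
  overhang-empty {s} s≤d (B ∷ l) (a , refl , _ , tf , a∈l) =
    1+n≰n (≤-trans (+-cancelʳ-≤ a (suc d) s (subst (_≤ s + a) (+-comm a (suc d)) (TwinFree-below l tf a∈l))) s≤d)

  overhang-base : r ≤ d → HasCard (Overhang d r (suc d)) (r ∸ 1)
  overhang-base r≤d = HasCard-bijection pair excess pair-overhang excess-between excess-pair pair-excess (Between-card r)
    where
    excess : List ℕ → ℕ
    excess [] = 0
    excess (B ∷ _) = B ∸ suc d
    pair : ℕ → List ℕ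
    pair a = suc d + a ∷ a ∷ []
    pair-overhang : ∀ a → Between r a → Overhang d r (suc d) (pair a)
    pair-overhang a 1≤a<r@(1≤a , _) = a , refl , 1≤a<r , (≤-reflexive (cong suc (+-comm a d)) , 1≤a) , here refl
    excess-between : ∀ l → Overhang d r (suc d) l → Between r (excess l)
    excess-between (B ∷ l) (a , refl , 1≤a<r , _) = subst (Between r) (sym (m+n∸m≡n (suc d) a)) 1≤a<r
    excess-pair : ∀ a → Between r a → excess (pair a) ≡ a
    excess-pair a _ = m+n∸m≡n (suc d) a
    only-a : ∀ {a} l → a < r → TwinFree d (suc d + a ∷ l) → a ∈ l → l ≡ a ∷ []
    only-a (_ ∷ []) _ _ (here refl) = refl
    only-a (_ ∷ z ∷ l) a<r (_ , z+d<a , _) (here refl) =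
      ⊥-elim (1+n≰n (≤-trans a<r (≤-trans r≤d (≤-trans (m≤n+m d z) (<⇒≤ z+d<a)))))
    only-a {a} (y ∷ l) _ (y+d<1+d+a , tf) (there a∈l) =
      ⊥-elim (m+1+n≰m a (≤-trans (TwinFree-below l tf a∈l) y≤a))
      where
      y≤a : y ≤ a
      y≤a = +-cancelʳ-≤ d y a (subst (y + d ≤_) (+-comm d a) (s≤s⁻¹ y+d<1+d+a))
    pair-excess : ∀ l → Overhang d r (suc d) l → pair (excess l) ≡ l
    pair-excess (B ∷ l) (a , refl , (_ , a<r) , tf , a∈l)
      rewrite m+n∸m≡n (suc d) a | only-a l a<r tf a∈l = refl

  overhang-step : ∀ {m x y} → HasCard (Overhang d r (suc (m + d))) x → HasCard (Overhang d r (suc m)) y →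
    HasCard (Overhang d r (suc (suc (m + d)))) (x + y)
  overhang-step {m} hx hy =
    HasCard-⊎ (λ l → mk⇔ (split l) (join l)) disjoint
      (HasCard-bijection raise lower raise-loose lower-overhang (λ { (_ ∷ _) _ → refl }) lower-raise hx)
      (HasCard-bijection extend (drop 1) extend-tight shrink-overhang (λ { (_ ∷ _) _ → refl }) shrink-extend hy)
    where
    s : ℕ
    s = suc (suc (m + d))
    Loose Tight : List ℕ → Set
    Loose (B ∷ y ∷ l) = Overhang d r s (B ∷ y ∷ l) × suc (y + d) < B
    Loose _ = ⊥
    Tight (B ∷ y ∷ l) = Overhang d r s (B ∷ y ∷ l) × B ≡ suc (y + d)
    Tight _ = ⊥
    split : ∀ l → Overhang d r s l → Loose l ⊎ Tight l
    split (B ∷ y ∷ l) o@(_ , _ , _ , (y+d<B , _) , _) with m≤n⇒m<n∨m≡n y+d<B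
    ... | inj₁ loose = inj₁ (o , loose)
    ... | inj₂ tight = inj₂ (o , sym tight)
    join : ∀ l → Loose l ⊎ Tight l → Overhang d r s l
    join (B ∷ y ∷ l) (inj₁ (o , _)) = o
    join (B ∷ y ∷ l) (inj₂ (o , _)) = o
    disjoint : ∀ l → Loose l → Tight l → ⊥
    disjoint (B ∷ y ∷ l) (_ , loose) (_ , refl) = 1+n≰n loose
    raise lower : List ℕ → List ℕ
    raise [] = []
    raise (B ∷ l) = suc B ∷ l
    lower [] = []
    lower (B ∷ l) = pred B ∷ l
    raise-loose : ∀ l → Overhang d r (suc (m + d)) l → Loose (raise l)
    raise-loose (B ∷ y ∷ l) (a , B≡ , a-ok , (y+d<B , tf) , a∈) =
      (a , cong suc B≡ , a-ok , (m≤n⇒m≤1+n y+d<B , tf) , a∈) , s≤s y+d<B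
    lower-overhang : ∀ l → Loose l → Overhang d r (suc (m + d)) (lower l)
    lower-overhang (B ∷ y ∷ l) ((a , B≡ , a-ok , (_ , tf) , a∈) , loose) =
      a , cong pred B≡ , a-ok , (pred-mono-≤ loose , tf) , a∈
    lower-raise : ∀ l → Loose l → raise (lower l) ≡ l
    lower-raise (B ∷ y ∷ l) ((a , refl , _) , _) = refl
    top-after-extend : ∀ m a d → suc (suc m + a + d) ≡ suc (suc (m + d)) + a
    top-after-extend = solve-∀
    extend : List ℕ → List ℕ
    extend [] = []
    extend (B ∷ l) = suc (B + d) ∷ B ∷ l
    extend-tight : ∀ l → Overhang d r (suc m) l → Tight (extend l)
    extend-tight (B ∷ l) (a , refl , a-ok , tf , a∈l) =
      (a , top-after-extend m a d , a-ok , (≤-refl , tf) , there a∈l) , refl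
    shrink-overhang : ∀ l → Tight l → Overhang d r (suc m) (drop 1 l)
    shrink-overhang (B ∷ y ∷ l) ((a , B≡ , a-ok , (_ , tf) , a∈) , B≡y+d+1) =
      a , y≡ , a-ok , tf , below a∈
      where
      y≡ : y ≡ suc m + a
      y≡ = +-cancelʳ-≡ d y (suc m + a) (suc-injective (trans (sym B≡y+d+1) (trans B≡ (sym (top-after-extend m a d)))))
      below : a ∈ y ∷ l → a ∈ l
      below (here a≡y) = ⊥-elim (m+1+n≰m a (≤-reflexive (sym (trans a≡y (trans y≡ (+-comm (suc m) a))))))
      below (there a∈l) = a∈l
    shrink-extend : ∀ l → Tight l → extend (drop 1 l) ≡ l
    shrink-extend (B ∷ y ∷ l) (_ , B≡y+d+1) = cong (_∷ y ∷ l) (sym B≡y+d+1)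

  overhang-finite : r ≤ d → ∀ s → ∃ (HasCard (Overhang d r s))
  overhang-finite r≤d = <-rec _ go
    where
    Finite : ℕ → Set
    Finite s = ∃ (HasCard (Overhang d r s))
    go : ∀ s → (∀ {t} → t < s → Finite t) → Finite s
    go s rec with ≤-or-above d s
    ... | inj₁ s≤d = 0 , HasCard-empty (overhang-empty s≤d)
    go .(suc (zero + d)) rec | inj₂ (zero , refl) = r ∸ 1 , overhang-base r≤d
    go .(suc (suc m + d)) rec | inj₂ (suc m , refl) =
      let x , hx = rec (n<1+n (suc (m + d)))
          y , hy = rec (s≤s (s≤s (m≤m+n m d)))
      in x + y , overhang-step hx hy

-- Partitions with d-distinct parts and their β-sets

DistinctBy : ℕ → List ℕ → Set
DistinctBy d [] = ⊤
DistinctBy d (x ∷ []) = 1 ≤ x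
DistinctBy d (x ∷ y ∷ l) = y + d ≤ x × DistinctBy d (y ∷ l)

module _ {d : ℕ} where

  DistinctBy-tail : ∀ {x} μ → DistinctBy d (x ∷ μ) → DistinctBy d μ
  DistinctBy-tail [] _ = tt
  DistinctBy-tail (y ∷ μ) (_ , dμ) = dμ

  DistinctBy-mono : ∀ {e} → e ≤ d → ∀ l → DistinctBy d l → DistinctBy e l
  DistinctBy-mono e≤d [] _ = tt
  DistinctBy-mono e≤d (x ∷ []) 1≤x = 1≤x
  DistinctBy-mono e≤d (x ∷ y ∷ l) (y+d≤x , dl) =
    ≤-trans (+-monoʳ-≤ y e≤d) y+d≤x , DistinctBy-mono e≤d (y ∷ l) dl

  partition⇒DistinctBy : ∀ l → IsPartition l → DDistinct d l → DistinctBy d l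
  partition⇒DistinctBy [] _ _ = tt
  partition⇒DistinctBy (x ∷ []) (0<x ∷ _ , _) _ = 0<x
  partition⇒DistinctBy (x ∷ y ∷ l) (0<x ∷ pos , noninc) gaps =
    gaps 0 (s≤s (s≤s z≤n)) ,
    partition⇒DistinctBy (y ∷ l) (pos , λ i → noninc (suc i)) (λ i → gaps (suc i) ∘ s≤s)

  DistinctBy⇒IsPartition : ∀ l → DistinctBy d l → IsPartition l
  DistinctBy⇒IsPartition l dl = positive l dl , nonincreasing l dl
    where
    positive : ∀ l → DistinctBy d l → All (0 <_) l
    positive [] _ = []
    positive (x ∷ []) 0<x = 0<x ∷ []
    positive (x ∷ y ∷ l) (y+d≤x , dl) with positive (y ∷ l) dl
    ... | 0<y ∷ pos = ≤-trans 0<y (≤-trans (m≤m+n y d) y+d≤x) ∷ 0<y ∷ pos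
    nonincreasing : ∀ l → DistinctBy d l → ∀ i → part l (suc i) ≤ part l i
    nonincreasing [] _ _ = z≤n
    nonincreasing (x ∷ []) _ _ = z≤n
    nonincreasing (x ∷ y ∷ l) (y+d≤x , _) zero = ≤-trans (m≤m+n y d) y+d≤x
    nonincreasing (x ∷ y ∷ l) (_ , dl) (suc i) = nonincreasing (y ∷ l) dl i

  DistinctBy⇒DDistinct : ∀ l → DistinctBy d l → DDistinct d l
  DistinctBy⇒DDistinct (x ∷ y ∷ l) (y+d≤x , _) zero _ = y+d≤x
  DistinctBy⇒DDistinct (x ∷ y ∷ l) (_ , dl) (suc i) (s≤s i+1<len) = DistinctBy⇒DDistinct (y ∷ l) dl i i+1<len
  DistinctBy⇒DDistinct (x ∷ []) _ i (s≤s ())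

beta : List ℕ → List ℕ
beta [] = []
beta (x ∷ l) = x + length l ∷ beta l

unbeta : List ℕ → List ℕ
unbeta [] = []
unbeta (B ∷ l) = B ∸ length l ∷ unbeta l

length-beta : ∀ l → length (beta l) ≡ length l
length-beta [] = refl
length-beta (x ∷ l) = cong suc (length-beta l)

length-unbeta : ∀ l → length (unbeta l) ≡ length l
length-unbeta [] = refl
length-unbeta (x ∷ l) = cong suc (length-unbeta l)

unbeta-beta : ∀ l → unbeta (beta l) ≡ l
unbeta-beta [] = refl
unbeta-beta (x ∷ l) rewrite length-beta l = cong₂ _∷_ (m+n∸n≡m x (length l)) (unbeta-beta l)

gap-shift : ∀ y L d → suc (y + L + d) ≡ y + d + suc L
gap-shift = solve-∀

module _ {d : ℕ} where

  TwinFree-length : ∀ {B} l → TwinFree d (B ∷ l) → length l < B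
  TwinFree-length [] 1≤B = 1≤B
  TwinFree-length (y ∷ l) (y+d<B , tf) = ≤-trans (s≤s (TwinFree-length l tf)) (≤-trans (s≤s (m≤m+n y d)) y+d<B)

  beta-unbeta : ∀ l → TwinFree d l → beta (unbeta l) ≡ l
  beta-unbeta [] _ = refl
  beta-unbeta (B ∷ l) tf rewrite length-unbeta l =
    cong₂ _∷_ (m∸n+n≡m (<⇒≤ (TwinFree-length l tf))) (beta-unbeta l (TwinFree-tail l tf))

  DistinctBy⇒TwinFree-beta : ∀ l → DistinctBy d l → TwinFree d (beta l)
  DistinctBy⇒TwinFree-beta [] _ = tt
  DistinctBy⇒TwinFree-beta (x ∷ []) 1≤x = ≤-trans 1≤x (m≤m+n x 0)
  DistinctBy⇒TwinFree-beta (x ∷ y ∷ l) (y+d≤x , dl) =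
    subst (_≤ x + suc (length l)) (sym (gap-shift y (length l) d)) (+-monoˡ-≤ (suc (length l)) y+d≤x) ,
    DistinctBy⇒TwinFree-beta (y ∷ l) dl

  TwinFree-beta⇒DistinctBy : ∀ l → TwinFree d (beta l) → DistinctBy d l
  TwinFree-beta⇒DistinctBy [] _ = tt
  TwinFree-beta⇒DistinctBy (x ∷ []) 1≤x+0 = subst (1 ≤_) (+-identityʳ x) 1≤x+0
  TwinFree-beta⇒DistinctBy (x ∷ y ∷ l) (gap , tf) =
    +-cancelʳ-≤ (suc (length l)) (y + d) x (subst (_≤ x + suc (length l)) (gap-shift y (length l) d) gap) ,
    TwinFree-beta⇒DistinctBy (y ∷ l) tf

-- Hook lengths and cores

module _ {j : ℕ} where

  colLen-∷-< : ∀ {x} μ → j < x → colLen (x ∷ μ) j ≡ suc (colLen μ j)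
  colLen-∷-< μ j<x = cong length (filter-accept (j <?_) j<x)

  colLen-∷-≮ : ∀ {x} μ → ¬ j < x → colLen (x ∷ μ) j ≡ colLen μ j
  colLen-∷-≮ μ j≮x = cong length (filter-reject (j <?_) j≮x)

  colLen-≤ : ∀ μ → All (_≤ j) μ → colLen μ j ≡ 0
  colLen-≤ [] _ = refl
  colLen-≤ (x ∷ μ) (x≤j ∷ μ≤j) = trans (colLen-∷-≮ μ (≤⇒≯ x≤j)) (colLen-≤ μ μ≤j)

rowHook : ℕ → List ℕ → ℕ → ℕ
rowHook x μ j = suc ((x ∸ suc j) + colLen μ j)

module _ {x j : ℕ} where

  hook-first-row : ∀ μ → j < x → hook (x ∷ μ) 0 j ≡ rowHook x μ j
  hook-first-row μ j<x rewrite colLen-∷-< μ j<x = refl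

  hook-lower-row : ∀ {i} μ → j < x → hook (x ∷ μ) (suc i) j ≡ hook μ i j
  hook-lower-row μ j<x rewrite colLen-∷-< μ j<x = refl

  rowHook-+ : ∀ μ → j < x → j + rowHook x μ j ≡ x + colLen μ j
  rowHook-+ μ j<x = begin
    j + suc (x ∸ suc j + c)   ≡⟨ +-suc j _ ⟩
    suc (j + (x ∸ suc j + c)) ≡⟨ cong suc (+-assoc j _ c) ⟨
    suc j + (x ∸ suc j) + c   ≡⟨ cong (_+ c) (m+[n∸m]≡n j<x) ⟩
    x + c                     ∎
    where
    open ≡-Reasoning
    c : ℕ
    c = colLen μ j

part-≤ : ∀ {x} μ i → All (_≤ x) μ → part μ i ≤ x
part-≤ [] i _ = z≤n
part-≤ (y ∷ μ) zero (y≤x ∷ _) = y≤x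
part-≤ (y ∷ μ) (suc i) (_ ∷ μ≤x) = part-≤ μ i μ≤x

FirstRowAvoids : ℕ → ℕ → List ℕ → Set
FirstRowAvoids t x μ = ∀ j → j < x → rowHook x μ j ≢ t

IsCore-∷ : ∀ {t x} μ → All (_≤ x) μ → IsCore t (x ∷ μ) ⇔ (FirstRowAvoids t x μ × IsCore t μ)
IsCore-∷ {t} {x} μ μ≤x = mk⇔
  (λ core → (λ j j<x → core 0 j (s≤s z≤n , j<x) ∘ trans (hook-first-row μ j<x)) ,
            (λ i j (i<k , j<μᵢ) → core (suc i) j (s≤s i<k , j<μᵢ) ∘ trans (hook-lower-row μ (below j<μᵢ))))
  (λ { (row , core) → λ where
         zero j (_ , j<x) → row j j<x ∘ trans (sym (hook-first-row μ j<x))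
         (suc i) j (s≤s i<k , j<μᵢ) → core i j (i<k , j<μᵢ) ∘ trans (sym (hook-lower-row μ (below j<μᵢ))) })
  where
  below : ∀ {i j} → j < part μ i → j < x
  below {i} j<μᵢ = <-≤-trans j<μᵢ (part-≤ μ i μ≤x)

DistinctBy-below-head : ∀ {x} μ → DistinctBy 1 (x ∷ μ) → All (_< x) μ
DistinctBy-below-head [] _ = []
DistinctBy-below-head {x} (y ∷ μ) (y+1≤x , dμ) =
  y<x ∷ All.map (λ z<y → <-trans z<y y<x) (DistinctBy-below-head μ dμ)
  where
  y<x : y < x
  y<x = subst (_≤ x) (+-comm y 1) y+1≤x

beta-below : ∀ {z y} ν → DistinctBy 1 (z ∷ ν) → y ∈ beta ν → y < z + length ν
beta-below {z} {y} ν dzν y∈ =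
  ≤-trans (m<m+n y (s≤s z≤n)) (TwinFree-below (beta ν) (DistinctBy⇒TwinFree-beta (z ∷ ν) dzν) y∈)

rowHook-∷-< : ∀ {x j} z ν → j < x → j < z → j + rowHook x (z ∷ ν) j ≡ x + suc (colLen ν j)
rowHook-∷-< {x} z ν j<x j<z = trans (rowHook-+ (z ∷ ν) j<x) (cong (_+_ x) (colLen-∷-< ν j<z))

rowHook-∷-≥ : ∀ {x j} z ν → DistinctBy 1 (z ∷ ν) → j < x → z ≤ j → j + rowHook x (z ∷ ν) j ≡ x
rowHook-∷-≥ {x} {j} z ν dzν j<x z≤j =
  trans (rowHook-+ (z ∷ ν) j<x) (trans (cong (_+_ x) (colLen-≤ (z ∷ ν) zν≤j)) (+-identityʳ x))
  where
  zν≤j : All (_≤ j) (z ∷ ν)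
  zν≤j = z≤j ∷ All.map (λ w<z → ≤-trans (<⇒≤ w<z) z≤j) (DistinctBy-below-head ν dzν)

swap-summands : ∀ a b c d → (a + b) + (c + d) ≡ (a + d) + (c + b)
swap-summands = solve-∀

exchange-suc : ∀ x c z L → (x + suc c) + (z + L) ≡ (z + c) + (x + suc L)
exchange-suc = solve-∀

firstRow-hook-gap : ∀ x μ {j} → DistinctBy 1 (x ∷ μ) → j < x →
  ∃ λ y → y + rowHook x μ j ≡ x + length μ × y ∉ beta μ
firstRow-hook-gap x [] _ j<x = _ , rowHook-+ [] j<x , λ ()
firstRow-hook-gap x (z ∷ ν) {j} (_ , dzν) j<x with j <? z
... | yes j<z with firstRow-hook-gap z ν dzν j<z
...   | y , y+h′≡ , y∉ = y , y+h≡ , λ where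
         (here y≡) → m+1+n≰m y (≤-reflexive (trans y+h′≡ (sym y≡)))
         (there y∈) → y∉ y∈
  where
  open ≡-Reasoning
  y+h≡ : y + rowHook x (z ∷ ν) j ≡ x + suc (length ν)
  y+h≡ = +-cancelˡ-≡ (z + colLen ν j) _ _ (begin
    (z + colLen ν j) + (y + rowHook x (z ∷ ν) j)       ≡⟨ cong (_+ (y + rowHook x (z ∷ ν) j)) (rowHook-+ ν j<z) ⟨
    (j + rowHook z ν j) + (y + rowHook x (z ∷ ν) j)   ≡⟨ swap-summands j _ y _ ⟩
    (j + rowHook x (z ∷ ν) j) + (y + rowHook z ν j)   ≡⟨ cong₂ _+_ (rowHook-∷-< z ν j<x j<z) y+h′≡ ⟩
    (x + suc (colLen ν j)) + (z + length ν)           ≡⟨ exchange-suc x _ z _ ⟩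
    (z + colLen ν j) + (x + suc (length ν))           ∎)
firstRow-hook-gap x (z ∷ ν) {j} (_ , dzν) j<x | no j≮z = j + suc L , y+h≡ , λ where
       (here y≡) → <⇒≢ z+L<y (sym y≡)
       (there y∈) → <-asym z+L<y (beta-below ν dzν y∈)
  where
  L : ℕ
  L = length ν
  z≤j : z ≤ j
  z≤j = ≮⇒≥ j≮z
  z+L<y : z + L < j + suc L
  z+L<y = subst (_≤ j + suc L) (+-suc z L) (+-monoˡ-≤ (suc L) z≤j)
  y+h≡ : j + suc L + rowHook x (z ∷ ν) j ≡ x + suc L
  y+h≡ = trans (xy∙z≈xz∙y j _ _) (cong (_+ suc L) (rowHook-∷-≥ z ν dzν j<x z≤j))

gap-firstRow-hook : ∀ x μ {y t} → DistinctBy 1 (x ∷ μ) → y + t ≡ x + length μ → 1 ≤ t → y ∉ beta μ →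
  ∃ λ j → j < x × rowHook x μ j ≡ t
gap-firstRow-hook x [] {y} _ y+t≡x+0 1≤t _ =
  y , y<x , +-cancelˡ-≡ y _ _ (trans (rowHook-+ [] y<x) (sym y+t≡x+0))
  where
  y<x : y < x
  y<x = ≤-trans (m<m+n y 1≤t) (≤-reflexive (trans y+t≡x+0 (+-identityʳ x)))
gap-firstRow-hook x (z ∷ ν) {y} {t} (z+1≤x , dzν) y+t≡ 1≤t y∉ with <-cmp y (z + length ν)
... | tri≈ _ y≡ _ = ⊥-elim (y∉ (here y≡))
... | tri> _ _ z+L<y = j , j<x , +-cancelˡ-≡ j _ _ j+h≡j+t
  where
  open ≡-Reasoning
  L : ℕ
  L = length ν
  j : ℕ
  j = y ∸ suc L
  j+1+L≡y : j + suc L ≡ y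
  j+1+L≡y = m∸n+n≡m (≤-trans (s≤s (m≤n+m L z)) z+L<y)
  z≤j : z ≤ j
  z≤j = m+n≤o⇒m≤o∸n z (subst (_≤ y) (sym (+-suc z L)) z+L<y)
  j+t≡x : j + t ≡ x
  j+t≡x = +-cancelʳ-≡ (suc L) _ _ (begin
    j + t + suc L   ≡⟨ xy∙z≈xz∙y j t _ ⟩
    j + suc L + t   ≡⟨ cong (_+ t) j+1+L≡y ⟩
    y + t           ≡⟨ y+t≡ ⟩
    x + suc L       ∎)
  j<x : j < x
  j<x = ≤-trans (m<m+n j 1≤t) (≤-reflexive j+t≡x)
  j+h≡j+t : j + rowHook x (z ∷ ν) j ≡ j + t
  j+h≡j+t = trans (rowHook-∷-≥ z ν dzν j<x z≤j) (sym j+t≡x)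
... | tri< y<z+L _ _
  with gap-firstRow-hook z ν dzν (m+[n∸m]≡n (<⇒≤ y<z+L)) (m<n⇒0<n∸m y<z+L) (y∉ ∘ there)
...   | j , j<z , h′≡w = j , <-trans j<z z<x , +-cancelʳ-≡ (j + w + y) _ _ (begin
    h + (j + w + y)                    ≡⟨ regroupˡ h j w y ⟩
    (j + h) + (y + w)                  ≡⟨ cong₂ _+_ (rowHook-∷-< z ν (<-trans j<z z<x) j<z) y+w≡ ⟩
    (x + suc (colLen ν j)) + (z + L)   ≡⟨ exchange-suc x _ z L ⟩
    (z + colLen ν j) + (x + suc L)     ≡⟨ cong₂ _+_ j+w≡ y+t≡ ⟨
    (j + w) + (y + t)                  ≡⟨ regroupʳ j w y t ⟩
    t + (j + w + y)                    ∎)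
  where
  open ≡-Reasoning
  L : ℕ
  L = length ν
  w h : ℕ
  w = z + L ∸ y
  h = rowHook x (z ∷ ν) j
  z<x : z < x
  z<x = subst (_≤ x) (+-comm z 1) z+1≤x
  y+w≡ : y + w ≡ z + L
  y+w≡ = m+[n∸m]≡n (<⇒≤ y<z+L)
  j+w≡ : j + w ≡ z + colLen ν j
  j+w≡ = trans (cong (_+_ j) (sym h′≡w)) (rowHook-+ ν j<z)
  regroupˡ : ∀ h j w y → h + (j + w + y) ≡ (j + h) + (y + w)
  regroupˡ = solve-∀
  regroupʳ : ∀ j w y t → (j + w) + (y + t) ≡ t + (j + w + y)
  regroupʳ = solve-∀

DownClosed : ℕ → List ℕ → Set
DownClosed t [] = ⊤
DownClosed t (B ∷ l) = (∀ y → y + t ≡ B → y ∈ l) × DownClosed t l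

DownClosed-vacuous : ∀ {t} l → All (_< t) l → DownClosed t l
DownClosed-vacuous [] _ = tt
DownClosed-vacuous {t} (B ∷ l) (B<t ∷ l<t) =
  (λ y y+t≡B → ⊥-elim (<-irrefl refl (<-≤-trans B<t (subst (t ≤_) y+t≡B (m≤n+m t y))))) ,
  DownClosed-vacuous l l<t

FirstRowAvoids⇔ : ∀ {t} x μ → DistinctBy 1 (x ∷ μ) → 1 ≤ t →
  FirstRowAvoids t x μ ⇔ (∀ y → y + t ≡ x + length μ → y ∈ beta μ)
FirstRowAvoids⇔ {t} x μ dxμ 1≤t = mk⇔ closed avoids
  where
  closed : FirstRowAvoids t x μ → ∀ y → y + t ≡ x + length μ → y ∈ beta μ
  closed row y y+t≡ with y ∈? beta μ
  ... | yes y∈ = y∈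
  ... | no y∉ with gap-firstRow-hook x μ dxμ y+t≡ 1≤t y∉
  ...   | j , j<x , h≡t = ⊥-elim (row j j<x h≡t)
  avoids : (∀ y → y + t ≡ x + length μ → y ∈ beta μ) → FirstRowAvoids t x μ
  avoids closed j j<x h≡t with firstRow-hook-gap x μ dxμ j<x
  ... | y , y+h≡ , y∉ = y∉ (closed y (trans (cong (_+_ y) (sym h≡t)) y+h≡))

IsCore⇔DownClosed-beta : ∀ {t} l → DistinctBy 1 l → 1 ≤ t → IsCore t l ⇔ DownClosed t (beta l)
IsCore⇔DownClosed-beta [] _ _ = mk⇔ (λ _ → tt) (λ { _ _ _ (() , _) })
IsCore⇔DownClosed-beta (x ∷ μ) dxμ 1≤t =
  (FirstRowAvoids⇔ x μ dxμ 1≤t ×-⇔ IsCore⇔DownClosed-beta μ (DistinctBy-tail μ dxμ) 1≤t)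
  ⇔-∘ IsCore-∷ μ (All.map <⇒≤ (DistinctBy-below-head μ dxμ))

-- Characterises the β-sets of (s+1, s+1+r)-cores with d-distinct parts.
CoreBetaSet : ℕ → ℕ → ℕ → List ℕ → Set
CoreBetaSet d r s l = TwinFreeUpTo d s l ⊎ Overhang d r (suc s) l

module _ {d r s : ℕ} where

  CoreBetaSet-TwinFree : ∀ l → CoreBetaSet d r s l → TwinFree d l
  CoreBetaSet-TwinFree l (inj₁ (tf , _)) = tf
  CoreBetaSet-TwinFree (B ∷ l) (inj₂ (_ , _ , _ , tf , _)) = tf

  CoreBetaSet⇒DownClosed : r ≤ d → ∀ l → CoreBetaSet d r s l →
    DownClosed (suc s) l × DownClosed (suc s + r) l
  CoreBetaSet⇒DownClosed r≤d [] _ = tt , tt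
  CoreBetaSet⇒DownClosed r≤d (B ∷ l) (inj₁ (tf , B≤s)) =
    DownClosed-vacuous (B ∷ l) Bl<1+s ,
    DownClosed-vacuous (B ∷ l) (All.map (λ y<1+s → <-≤-trans y<1+s (m≤m+n (suc s) r)) Bl<1+s)
    where
    Bl<1+s : All (_< suc s) (B ∷ l)
    Bl<1+s = s≤s B≤s ∷ All.map (λ y<B → <-≤-trans y<B (m≤n⇒m≤1+n B≤s)) (TwinFree-below-head l tf)
  CoreBetaSet⇒DownClosed r≤d (B ∷ l) (inj₂ (a , refl , (_ , a<r) , tf , a∈l)) =
    ((λ y y+1+s≡B → subst (_∈ l) (sym (+-cancelʳ-≡ (suc s) y a (trans y+1+s≡B (+-comm (suc s) a)))) a∈l) ,
     DownClosed-vacuous l l<1+s) ,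
    ((λ y y+1+s+r≡B → ⊥-elim (<-irrefl refl (<-≤-trans (+-monoʳ-< (suc s) a<r)
        (subst (suc s + r ≤_) y+1+s+r≡B (m≤n+m (suc s + r) y))))) ,
     DownClosed-vacuous l (All.map (λ y<1+s → <-≤-trans y<1+s (m≤m+n (suc s) r)) l<1+s))
    where
    l<1+s : All (_< suc s) l
    l<1+s = All.tabulate λ y∈l → +-cancelʳ-< (suc d) _ (suc s)
      (≤-<-trans (TwinFree-below l tf y∈l) (+-monoʳ-< (suc s) (≤-trans a<r (m≤n⇒m≤1+n r≤d))))

  DownClosed⇒CoreBetaSet : 1 ≤ r → r ≤ d → ∀ l → TwinFree d l →
    DownClosed (suc s) l → DownClosed (suc s + r) l → CoreBetaSet d r s l
  DownClosed⇒CoreBetaSet _ _ [] _ _ _ = inj₁ (tt , tt)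
  DownClosed⇒CoreBetaSet 1≤r r≤d (B ∷ l) tf (closed , _) (closed′ , _) with B ≤? s
  ... | yes B≤s = inj₁ (tf , B≤s)
  ... | no B≰s with m≤n⇒∃[o]m+o≡n (≰⇒> B≰s)
  ...   | zero , 1+s+0≡B =
    ⊥-elim (1+n≰n (TwinFree-pos l (TwinFree-tail l tf) (closed 0 (trans (sym (+-identityʳ (suc s))) 1+s+0≡B))))
  ...   | suc a , 1+s+a≡B with r ≤? suc a
  ...     | no r≰a = inj₂ (suc a , sym 1+s+a≡B , (s≤s z≤n , ≰⇒> r≰a) , tf , closed (suc a) (trans (+-comm (suc a) (suc s)) 1+s+a≡B))
  ...     | yes r≤a with m≤n⇒∃[o]m+o≡n r≤a
  ...       | k , r+k≡a = ⊥-elim (1+n≰n (≤-trans (+-cancelʳ-≤ k (suc d) r (subst (_≤ r + k) (+-comm k (suc d)) twins-apart)) r≤d))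
    where
    -- B - (s+1+r) and B - (s+1) are both in the set, only r ≤ d apart.
    k∈l : k ∈ l
    k∈l = closed′ k (trans (shuffle k (suc s) r) (trans (cong (_+_ (suc s)) r+k≡a) 1+s+a≡B))
      where
      shuffle : ∀ k S r → k + (S + r) ≡ S + (r + k)
      shuffle = solve-∀
    r+k∈l : r + k ∈ l
    r+k∈l = closed (r + k) (trans (+-comm (r + k) (suc s)) (trans (cong (_+_ (suc s)) r+k≡a) 1+s+a≡B))
    twins-apart : k + suc d ≤ r + k
    twins-apart = TwinFree-apart l (TwinFree-tail l tf) k∈l r+k∈l (≤-trans (m<m+n k 1≤r) (≤-reflexive (+-comm k r)))

  core-card : ∀ {x y} → 1 ≤ r → r ≤ d → HasCard (TwinFreeUpTo d s) x → HasCard (Overhang d r (suc s)) y →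
    HasCard (CoreDD d r (suc s)) (x + y)
  core-card 1≤r r≤d hx hy =
    HasCard-bijection unbeta beta beta-core core-beta
      (λ l b → beta-unbeta l (CoreBetaSet-TwinFree l b)) (λ la _ → unbeta-beta la)
      (HasCard-⊎ (λ _ → mk⇔ id id) disjoint hx hy)
    where
    1≤d : 1 ≤ d
    1≤d = ≤-trans 1≤r r≤d
    disjoint : ∀ l → TwinFreeUpTo d s l → Overhang d r (suc s) l → ⊥
    disjoint (B ∷ l) (_ , B≤s) (a , refl , _) = 1+n≰n (≤-trans (m≤m+n (suc s) a) B≤s)
    beta-core : ∀ l → CoreBetaSet d r s l → CoreDD d r (suc s) (unbeta l)
    beta-core l b = DistinctBy⇒IsPartition _ dλ , core (s≤s z≤n) (subst (DownClosed (suc s)) (sym l≡) closed) ,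
      core (s≤s z≤n) (subst (DownClosed (suc s + r)) (sym l≡) closed′) , DistinctBy⇒DDistinct _ dλ
      where
      l≡ : beta (unbeta l) ≡ l
      l≡ = beta-unbeta l (CoreBetaSet-TwinFree l b)
      dλ : DistinctBy d (unbeta l)
      dλ = TwinFree-beta⇒DistinctBy (unbeta l) (subst (TwinFree d) (sym l≡) (CoreBetaSet-TwinFree l b))
      closed : DownClosed (suc s) l
      closed = proj₁ (CoreBetaSet⇒DownClosed r≤d l b)
      closed′ : DownClosed (suc s + r) l
      closed′ = proj₂ (CoreBetaSet⇒DownClosed r≤d l b)
      core : ∀ {t} → 1 ≤ t → DownClosed t (beta (unbeta l)) → IsCore t (unbeta l)
      core 1≤t = from (IsCore⇔DownClosed-beta (unbeta l) (DistinctBy-mono 1≤d _ dλ) 1≤t)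
    core-beta : ∀ la → CoreDD d r (suc s) la → CoreBetaSet d r s (beta la)
    core-beta la (partition , core , core′ , gaps) =
      DownClosed⇒CoreBetaSet 1≤r r≤d (beta la) (DistinctBy⇒TwinFree-beta la dλ)
        (to (IsCore⇔DownClosed-beta la dλ₁ (s≤s z≤n)) core) (to (IsCore⇔DownClosed-beta la dλ₁ (s≤s z≤n)) core′)
      where
      dλ : DistinctBy d la
      dλ = partition⇒DistinctBy la partition gaps
      dλ₁ : DistinctBy 1 la
      dλ₁ = DistinctBy-mono 1≤d la dλ

-- The extension to s ≤ 0

module _ {d r : ℕ} {s : ℤ} (s≤0 : s ℤ.≤ + 0) (r≤d : r ≤ d) where

  InRange : ℤ → Set
  InRange x = (+ 1 ℤ.≤ x) × (x ℤ.≤ (s ℤ.+ + r) - + 1)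

  InRange-ℕ : ∀ {x} → InRange x → ∃ λ a → x ≡ + a × a ≤ r
  InRange-ℕ {+ a} (_ , x≤top) with ℤP.≤-trans x≤top (ℤP.≤-trans (ℤP.i-j≤i (s ℤ.+ + r) (+ 1)) (ℤP.+-monoˡ-≤ (+ r) s≤0))
  ... | ℤ.+≤+ a≤r = a , refl , a≤r

  InRange-close : ∀ {x y} → InRange x → InRange y → ¬ d < ∣ x - y ∣
  InRange-close x-in y-in d<∣x-y∣ with InRange-ℕ x-in | InRange-ℕ y-in
  ... | a , refl , a≤r | b , refl , b≤r = <⇒≱ d<∣x-y∣ (begin
    ∣ + a - + b ∣   ≡⟨ cong ∣_∣ (ℤP.[+m]-[+n]≡m⊖n a b) ⟩
    ∣ a ℤ.⊖ b ∣     ≤⟨ ℤP.∣m⊝n∣≤m⊔n a b ⟩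
    a ⊔ b           ≤⟨ ⊔-lub a≤r b≤r ⟩
    r               ≤⟨ r≤d ⟩
    d               ∎)
    where open ≤-Reasoning

ExtSet-negative : ∀ {d r} → r ≤ d → ∀ m → HasCard (ExtSet d r -[1+ m ]) 1
ExtSet-negative {d} {r} r≤d m = HasCard-singleton [] only-[] (Linked.[] , [] , (λ _ ()) , (λ _ ()) , (λ _ _ ()))
  where
  -- x and x - s = x + m + 1 would both be in the set.
  only-[] : ∀ β → ExtSet d r -[1+ m ] β → β ≡ []
  only-[] [] _ = refl
  only-[] (x ∷ β) (_ , in-range , shift-closed , _ , twin-free)
    with InRange-ℕ ℤ.-≤+ r≤d (All.lookup in-range (here refl))
  ... | a , refl , _ = ⊥-elim (InRange-close ℤ.-≤+ r≤d (All.lookup in-range (here refl)) (All.lookup in-range x+m+1∈)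
                                 (twin-free _ _ (here refl) x+m+1∈ λ a≡ → m+1+n≰m a (≤-reflexive (sym (ℤP.+-injective a≡)))))
    where
    x+m+1∈ : + a - -[1+ m ] ∈ + a ∷ β
    x+m+1∈ = shift-closed (+ a) (here refl) ℤ.-≤+

Singleton : ℕ → List ℤ → Set
Singleton r β = ∃ λ a → β ≡ + a ∷ [] × Between r a

ExtSet-zero : ∀ {d r} → suc r ≤ d → HasCard (ExtSet d (suc r) (+ 0)) (suc r)
ExtSet-zero {d} {r} r<d =
  HasCard-⊎ (λ β → mk⇔ (split β) (join β)) (λ { .[] refl (_ , () , _) })
    (HasCard-singleton [] (λ _ β≡[] → β≡[]) refl)
    (HasCard-bijection (λ a → + a ∷ []) headℕ (λ a a-ok → a , refl , a-ok) between (λ _ _ → refl) singleton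
      (Between-card (suc r)))
  where
  headℕ : List ℤ → ℕ
  headℕ [] = 0
  headℕ (x ∷ _) = ∣ x ∣
  between : ∀ β → Singleton (suc r) β → Between (suc r) (headℕ β)
  between .(+ a ∷ []) (a , refl , a-ok) = a-ok
  singleton : ∀ β → Singleton (suc r) β → + headℕ β ∷ [] ≡ β
  singleton .(+ a ∷ []) (a , refl , _) = refl
  split : ∀ β → ExtSet d (suc r) (+ 0) β → β ≡ [] ⊎ Singleton (suc r) β
  split [] _ = inj₁ refl
  split (.(+ a) ∷ []) (_ , (ℤ.+≤+ {n = a} 1≤a , ℤ.+≤+ a≤r) ∷ [] , _) = inj₂ (a , refl , 1≤a , s≤s a≤r)
  split (x ∷ y ∷ β) (x<y Linked.∷ _ , x-in ∷ y-in ∷ _ , _ , _ , twin-free) =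
    ⊥-elim (InRange-close (ℤ.+≤+ z≤n) r<d x-in y-in (twin-free x y (here refl) (there (here refl)) (ℤP.<⇒≢ x<y)))
  join : ∀ β → β ≡ [] ⊎ Singleton (suc r) β → ExtSet d (suc r) (+ 0) β
  join .[] (inj₁ refl) = Linked.[] , [] , (λ _ ()) , (λ _ ()) , (λ _ _ ())
  join .(+ a ∷ []) (inj₂ (a , refl , 1≤a , a<1+r)) =
    Linked.[-] , (ℤ.+≤+ 1≤a , ℤ.+≤+ (s≤s⁻¹ a<1+r)) ∷ [] ,
    (λ { _ (here refl) _ → here (ℤP.+-identityʳ (+ a)) }) ,
    (λ { _ (here refl) (ℤ.+≤+ 1+r≤a) → ⊥-elim (<⇒≱ a<1+r 1+r≤a) }) ,
    (λ { _ _ (here refl) (here refl) a≢a → ⊥-elim (a≢a refl) })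

-- The recurrence

[+m]-[+n+1]≡-[1+n∸m] : ∀ {m} n → m ≤ n → + m - + (n + 1) ≡ -[1+ (n ∸ m) ]
[+m]-[+n+1]≡-[1+n∸m] {m} n m≤n = begin
  + m - + (n + 1)       ≡⟨ ℤP.[+m]-[+n]≡m⊖n m (n + 1) ⟩
  m ℤ.⊖ (n + 1)         ≡⟨ ℤP.⊖-< (≤-trans (s≤s m≤n) (≤-reflexive (+-comm 1 n))) ⟩
  ℤ.- + (n + 1 ∸ m)     ≡⟨ cong (λ k → ℤ.- + k) (trans (+-∸-comm 1 m≤n) (+-comm (n ∸ m) 1)) ⟩
  -[1+ (n ∸ m) ]        ∎
  where open ≡-Reasoning

[+1+n]-[+n+1]≡0 : ∀ n → + suc n - + (n + 1) ≡ + 0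
[+1+n]-[+n+1]≡0 n = trans (ℤP.[+m]-[+n]≡m⊖n (suc n) (n + 1))
  (trans (cong (suc n ℤ.⊖_) (+-comm n 1)) (ℤP.n⊖n≡0 (suc n)))

[+m+n]-[+n]≡+m : ∀ m n → + (m + n) - + n ≡ + m
[+m+n]-[+n]≡+m m n = trans (ℤP.[+m]-[+n]≡m⊖n (m + n) n)
  (trans (ℤP.⊖-≥ (m≤n+m n m)) (cong +_ (m+n∸n≡m m n)))

twinFreeUpTo-suc-≤ : ∀ {d k x} → k ≤ d → HasCard (TwinFreeUpTo d k) x → HasCard (TwinFreeUpTo d (suc k)) (x + 1)
twinFreeUpTo-suc-≤ {d} k≤d hx =
  twinFreeUpTo-suc hx (subst (λ n → HasCard (TwinFreeUpTo d n) 1) (sym (m≤n⇒m∸n≡0 k≤d)) twinFreeUpTo-zero)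

Recurrence : ℕ → ℕ → ℕ → Set
Recurrence d r s = Σ ℕ λ a → Σ ℕ λ b →
  NCount d r (+ s - + 1) a × NCount d r (+ s - + (d + 1)) b × NCount d r (+ s) (a + b)

module _ {d r : ℕ} (1≤r : 1 ≤ r) (r≤d : r ≤ d) where

  NCount-one : NCount d r (+ 1) 1
  NCount-one = core-card 1≤r r≤d twinFreeUpTo-zero (HasCard-empty (overhang-empty (≤-trans 1≤r r≤d)))

  recurrence-below : ∀ k → suc (suc k) ≤ d → Recurrence d r (suc (suc k))
  recurrence-below k 2+k≤d with twinFreeUpTo-finite k
  ... | x , hx = x + 0 , 1 ,
    core-card 1≤r r≤d hx (HasCard-empty (overhang-empty (<⇒≤ 2+k≤d))) ,
    subst (λ z → NCount d r z 1) (sym ([+m]-[+n+1]≡-[1+n∸m] d 2+k≤d)) (ExtSet-negative r≤d _) ,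
    subst (HasCard _) (trans (+-identityʳ (x + 1)) (cong (_+ 1) (sym (+-identityʳ x))))
      (core-card 1≤r r≤d (twinFreeUpTo-suc-≤ (≤-trans (n≤1+n k) (<⇒≤ 2+k≤d)) hx) (HasCard-empty (overhang-empty 2+k≤d)))

  recurrence-above : ∀ m → Recurrence d r (suc (suc (m + d)))
  recurrence-above m with twinFreeUpTo-finite (m + d) | twinFreeUpTo-finite m
                        | overhang-finite r≤d (suc (m + d)) | overhang-finite r≤d (suc m)
  ... | x , hx | y , hy | u , hu | v , hv = x + u , y + v ,
    core-card 1≤r r≤d hx hu ,
    subst (λ z → NCount d r z (y + v)) (sym (trans (cong (λ n → + n - + (d + 1)) 2+m+d≡) ([+m+n]-[+n]≡+m (suc m) (d + 1))))
      (core-card 1≤r r≤d hy hv) ,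
    subst (HasCard _) (interchange x y u v)
      (core-card 1≤r r≤d (twinFreeUpTo-suc hx (subst (λ n → HasCard (TwinFreeUpTo d n) y) (sym (m+n∸n≡m m d)) hy))
                         (overhang-step hu hv))
    where
    2+m+d≡ : suc (suc (m + d)) ≡ suc m + (d + 1)
    2+m+d≡ = cong suc (sym (trans (cong (_+_ m) (+-comm d 1)) (+-suc m d)))

recurrence-at : ∀ {k r} → 1 ≤ r → r ≤ suc k → Recurrence (suc k) r (suc (suc k))
recurrence-at {k} {suc r} 1≤r r<1+k with twinFreeUpTo-finite {suc k} k
... | x , hx = x + 0 , suc r ,
  core-card 1≤r r<1+k hx (HasCard-empty (overhang-empty ≤-refl)) ,
  subst (λ z → NCount (suc k) (suc r) z (suc r)) (sym ([+1+n]-[+n+1]≡0 (suc k))) (ExtSet-zero r<1+k) ,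
  subst (HasCard _) (+-rearrange x r)
    (core-card 1≤r r<1+k (twinFreeUpTo-suc-≤ (n≤1+n k) hx) (overhang-base r<1+k))
  where
  +-rearrange : ∀ x r → x + 1 + r ≡ x + 0 + suc r
  +-rearrange = solve-∀

theorem4p1 : (d r : ℕ) → 1 ≤ r → r ≤ d →
    NCount d r (+ 1) 1 ×
    ((s : ℕ) → 2 ≤ s →
      Σ ℕ λ a → Σ ℕ λ b →
        NCount d r (+ s - + 1) a ×
        NCount d r (+ s - + (d + 1)) b ×
        NCount d r (+ s) (a + b))
theorem4p1 d r 1≤r r≤d = NCount-one 1≤r r≤d , step
  where
  step : (s : ℕ) → 2 ≤ s → Recurrence d r s
  step (suc zero) (s≤s ())
  step (suc (suc k)) _ with ≤-or-above d (suc k)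
  ... | inj₂ (m , refl) = recurrence-above 1≤r r≤d m
  ... | inj₁ 1+k≤d with m≤n⇒m<n∨m≡n 1+k≤d
  ...   | inj₁ 2+k≤d = recurrence-below 1≤r r≤d k 2+k≤d
  ...   | inj₂ refl = recurrence-at 1≤r r≤d
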